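{- Let $G$ be a finite connected graph and let $J$ be a finite graph having an isolated vertex. Then $c_H(G\vee J)\le c_H(G)+1$.
   Context: $G\vee J$ denotes the join of $G$ and $J$: the disjoint union of $G$ and $J$ together with all edges between a vertex of $G$ and a vertex of $J$. Hyperopic Cops and Robbers on a finite connected simple graph $H$: one player controls $k$ cops, the other a single robber. The cops first choose starting vertices (several cops may share a vertex), then the robber chooses a starting vertex; afterwards, in each round, each cop moves to an adjacent vertex or stays put, and then the robber moves to an adjacent vertex or stays put. The robber always knows the cops' positions. The robber is invisible to the cops exactly when the robber's vertex is adjacent to the vertex of every cop (a robber on the same vertex as a cop is visible); otherwise the cops see the robber's position. The cops win if after finitely many rounds some cop occupies the robber's vertex, and the cops' strategy must guarantee this with certainty (no chance allowed). The hyperopic cop number $c_H(H)$ is the minimum $k$ for which $k$ cops have a winning strategy. -}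

module Defs where

open import Data.Nat using (ℕ; zero; suc; _+_; _<_; _≤_)
open import Data.Fin using (Fin; zero; suc; splitAt)
open import Data.Bool using (Bool; true; false; _∧_; if_then_else_)
open import Data.Maybe using (Maybe; just; nothing)
open import Data.Sum using (_⊎_; inj₁; inj₂)
open import Data.Product using (Σ; ∃; _×_; _,_; proj₁)
open import Data.List.NonEmpty using (List⁺; [_]; _∷⁺_; head)
open import Relation.Binary.PropositionalEquality using (_≡_; refl)

record Graph : Set where
  field
    n      : ℕ
    adj    : Fin n → Fin n → Bool
    sym    : ∀ u v → adj u v ≡ adj v u
    irrefl : ∀ v → adj v v ≡ false
open Graph public

V : Graph → Set
V H = Fin (n H)

data Reachable (H : Graph) : V H → V H → Set where
  here : ∀ {u} → Reachable H u u
  step : ∀ {u v w} → adj H u v ≡ true → Reachable H v w → Reachable H u w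

Connected : Graph → Set
Connected H = (0 < n H) × (∀ u v → Reachable H u v)

HasIsolatedVertex : Graph → Set
HasIsolatedVertex H = Σ (V H) λ v → ∀ u → adj H v u ≡ false

joinAdj : (G J : Graph) → V G ⊎ V J → V G ⊎ V J → Bool
joinAdj G J (inj₁ a) (inj₁ b) = adj G a b
joinAdj G J (inj₂ a) (inj₂ b) = adj J a b
joinAdj G J (inj₁ a) (inj₂ b) = true
joinAdj G J (inj₂ a) (inj₁ b) = true

joinAdj-sym : ∀ G J x y → joinAdj G J x y ≡ joinAdj G J y x
joinAdj-sym G J (inj₁ a) (inj₁ b) = sym G a b
joinAdj-sym G J (inj₂ a) (inj₂ b) = sym J a b
joinAdj-sym G J (inj₁ a) (inj₂ b) = refl
joinAdj-sym G J (inj₂ a) (inj₁ b) = refl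

joinAdj-irrefl : ∀ G J x → joinAdj G J x x ≡ false
joinAdj-irrefl G J (inj₁ a) = irrefl G a
joinAdj-irrefl G J (inj₂ a) = irrefl J a

_∨ᴳ_ : Graph → Graph → Graph
G ∨ᴳ J = record
  { n = n G + n J
  ; adj = λ u v → joinAdj G J (splitAt (n G) u) (splitAt (n G) v)
  ; sym = λ u v → joinAdj-sym G J (splitAt (n G) u) (splitAt (n G) v)
  ; irrefl = λ v → joinAdj-irrefl G J (splitAt (n G) v)
  }

Step : (H : Graph) → V H → V H → Set
Step H u v = (u ≡ v) ⊎ (adj H u v ≡ true)

Config : Graph → ℕ → Set
Config H k = Fin k → V H

allFin : ∀ k → (Fin k → Bool) → Bool
allFin zero    f = true
allFin (suc k) f = f zero ∧ allFin k (λ i → f (suc i))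

-- what the cops see of a robber at r: nothing (invisible) iff r is adjacent
-- to the vertex of every cop, otherwise r itself
view : (H : Graph) (k : ℕ) → Config H k → V H → Maybe (V H)
view H k c r = if allFin k (λ i → adj H (c i) r) then nothing else just r

Obs : Graph → ℕ → Set
Obs H k = Config H k × Maybe (V H)

-- a deterministic cop strategy: initial positions, and the next positions as a
-- function of the whole observation history (newest observation first);
-- every cop moves legally
record CopStrategy (H : Graph) (k : ℕ) : Set where
  field
    start : Config H k
    move  : List⁺ (Obs H k) → Config H k
    legal : ∀ h i → Step H (proj₁ (head h) i) (move h i)
open CopStrategy public

-- a robber play: robber positions r 0 (chosen after cops start), r 1, ...
LegalRobber : (H : Graph) → (ℕ → V H) → Set
LegalRobber H r = ∀ t → Step H (r t) (r (suc t))

-- observation history after round t (r t = robber position after round t)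
history : ∀ {H k} → CopStrategy H k → (ℕ → V H) → ℕ → List⁺ (Obs H k)
history {H} {k} S r zero    = [ (start S , view H k (start S) (r zero)) ]
history {H} {k} S r (suc t) =
  let c = move S (history S r t) in (c , view H k c (r (suc t))) ∷⁺ history S r t

cops : ∀ {H k} → CopStrategy H k → (ℕ → V H) → ℕ → Config H k
cops S r t = proj₁ (head (history S r t))

-- capture: some cop on the robber's vertex (either after the cops' move of
-- round t+1, or when the robber sits on a cop at time t)
Captured : ∀ {H k} → CopStrategy H k → (ℕ → V H) → Set
Captured {H} {k} S r = ∃ λ t → ∃ λ (i : Fin k) →
  (cops S r t i ≡ r t) ⊎ (cops S r (suc t) i ≡ r t)

Winning : ∀ {H k} → CopStrategy H k → Set
Winning {H} S = ∀ (r : ℕ → V H) → LegalRobber H r → Captured S r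

CopsWin : Graph → ℕ → Set
CopsWin H k = Σ (CopStrategy H k) Winning

IsHyperopicCopNumber : Graph → ℕ → Set
IsHyperopicCopNumber H k = CopsWin H k × (∀ m → CopsWin H m → k ≤ m)

-- Given a winning strategy for k cops on G, one extra cop is parked on the
-- isolated vertex w of J.  Being adjacent to every vertex of G and to no vertex
-- of J, this guard leaves the cops' view of a robber in G exactly as in G and
-- makes a robber in J always visible.  The other k cops replay the G-strategy
-- against the robber's G-positions.  As long as the robber stays in G this is
-- the play of the G-strategy, which ends in a capture; the moment it enters J
-- it is seen, while every other cop is in G and hence adjacent to it, so it is
-- caught in the next round.  Connectedness of G is used only to know that G
-- is nonempty, so that c_H(G) ≥ 1.
module Submission where

open import Defs hiding (sym)
open import Data.Nat using (ℕ; zero; suc; _≤_; _+_)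
open import Data.Nat.Properties using (+-comm)
open import Data.Fin using (Fin; zero; suc; splitAt; _↑ˡ_; _↑ʳ_; fromℕ<)
open import Data.Fin.Properties using (splitAt-↑ˡ; splitAt-↑ʳ; splitAt⁻¹-↑ˡ; splitAt⁻¹-↑ʳ; ↑ˡ-injective) renaming (_≟_ to _≟ᶠ_)
open import Data.Bool using (Bool; true; false; _∧_; if_then_else_) renaming (_≟_ to _≟ᵇ_)
open import Data.Maybe using (Maybe; just; nothing)
open import Data.Sum using (_⊎_; inj₁; inj₂; [_,_]′)
open import Data.Product using (∃; _,_; proj₁; proj₂)
open import Data.List using (List; []; _∷_)
open import Data.List.NonEmpty using (List⁺; [_]; _∷⁺_; head; _∷_)
open import Data.Empty using (⊥-elim)
open import Function using (id; const)
open import Relation.Nullary using (Dec; yes; no; ¬_)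
open import Relation.Nullary.Decidable using (_⊎-dec_)
open import Relation.Binary.PropositionalEquality using (_≡_; refl; sym; trans; cong; cong₂; subst; subst₂)
open Relation.Binary.PropositionalEquality.≡-Reasoning

allFin-cong : ∀ k {f g : Fin k → Bool} → (∀ i → f i ≡ g i) → allFin k f ≡ allFin k g
allFin-cong zero    f≗g = refl
allFin-cong (suc k) f≗g = cong₂ _∧_ (f≗g zero) (allFin-cong k (λ i → f≗g (suc i)))

step? : (H : Graph) (u v : V H) → Dec (Step H u v)
step? H u v = (u ≟ᶠ v) ⊎-dec (adj H u v ≟ᵇ true)

moveToward : (H : Graph) → V H → V H → V H
moveToward H u v with step? H u v
... | yes _ = v
... | no  _ = u

moveToward-legal : ∀ H u v → Step H u (moveToward H u v)
moveToward-legal H u v with step? H u v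
... | yes u→v = u→v
... | no  _   = inj₁ refl

moveToward-reaches : ∀ H {u v} → Step H u v → moveToward H u v ≡ v
moveToward-reaches H {u} {v} u→v with step? H u v
... | yes _   = refl
... | no  ¬u→v = ⊥-elim (¬u→v u→v)

history-sighting : ∀ {H k} (S : CopStrategy H k) r t →
                   proj₂ (head (history S r t)) ≡ view H k (cops S r t) (r t)
history-sighting S r zero    = refl
history-sighting S r (suc t) = refl

¬CopsWin-zero : (H : Graph) → V H → ¬ CopsWin H 0
¬CopsWin-zero H v (S , wins) with wins (λ _ → v) (λ _ → inj₁ refl)
... | _ , () , _

module Join (G J : Graph) where

  ιˡ : V G → V (G ∨ᴳ J)
  ιˡ x = x ↑ˡ n J

  ιʳ : V J → V (G ∨ᴳ J)
  ιʳ z = n G ↑ʳ z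

  adj-ιˡ-ιˡ : ∀ x y → adj (G ∨ᴳ J) (ιˡ x) (ιˡ y) ≡ adj G x y
  adj-ιˡ-ιˡ x y rewrite splitAt-↑ˡ (n G) x (n J) | splitAt-↑ˡ (n G) y (n J) = refl

  adj-ιˡ-ιʳ : ∀ x z → adj (G ∨ᴳ J) (ιˡ x) (ιʳ z) ≡ true
  adj-ιˡ-ιʳ x z rewrite splitAt-↑ˡ (n G) x (n J) | splitAt-↑ʳ (n G) (n J) z = refl

  adj-ιʳ-ιˡ : ∀ z x → adj (G ∨ᴳ J) (ιʳ z) (ιˡ x) ≡ true
  adj-ιʳ-ιˡ z x rewrite splitAt-↑ʳ (n G) (n J) z | splitAt-↑ˡ (n G) x (n J) = refl

  adj-ιʳ-ιʳ : ∀ z z′ → adj (G ∨ᴳ J) (ιʳ z) (ιʳ z′) ≡ adj J z z′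
  adj-ιʳ-ιʳ z z′ rewrite splitAt-↑ʳ (n G) (n J) z | splitAt-↑ʳ (n G) (n J) z′ = refl

  Step-ιˡ⁺ : ∀ {x y} → Step G x y → Step (G ∨ᴳ J) (ιˡ x) (ιˡ y)
  Step-ιˡ⁺ (inj₁ x≡y) = inj₁ (cong ιˡ x≡y)
  Step-ιˡ⁺ {x} {y} (inj₂ xy) = inj₂ (trans (adj-ιˡ-ιˡ x y) xy)

  Step-ιˡ⁻ : ∀ {x y} → Step (G ∨ᴳ J) (ιˡ x) (ιˡ y) → Step G x y
  Step-ιˡ⁻ {x} {y} (inj₁ ιx≡ιy) = inj₁ (↑ˡ-injective (n J) x y ιx≡ιy)
  Step-ιˡ⁻ {x} {y} (inj₂ xy)    = inj₂ (trans (sym (adj-ιˡ-ιˡ x y)) xy)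

  ιˡ-or-ιʳ : ∀ v → (∃ λ x → v ≡ ιˡ x) ⊎ (∃ λ z → v ≡ ιʳ z)
  ιˡ-or-ιʳ v with splitAt (n G) v in eq
  ... | inj₁ x = inj₁ (x , sym (splitAt⁻¹-↑ˡ eq))
  ... | inj₂ z = inj₂ (z , sym (splitAt⁻¹-↑ʳ eq))

  projˡ : V G → V (G ∨ᴳ J) → V G
  projˡ default v = [ id , const default ]′ (splitAt (n G) v)

  projˡ-ιˡ : ∀ default x → projˡ default (ιˡ x) ≡ x
  projˡ-ιˡ default x rewrite splitAt-↑ˡ (n G) x (n J) = refl

  seenInG : Maybe (V (G ∨ᴳ J)) → Maybe (V G)
  seenInG nothing  = nothing
  seenInG (just v) = [ just , const nothing ]′ (splitAt (n G) v)

  seenInG-ιˡ : ∀ b x → seenInG (if b then nothing else just (ιˡ x)) ≡ (if b then nothing else just x)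
  seenInG-ιˡ true  x = refl
  seenInG-ιˡ false x rewrite splitAt-↑ˡ (n G) x (n J) = refl

  chase : Maybe (V (G ∨ᴳ J)) → V G → V (G ∨ᴳ J)
  chase nothing  g = ιˡ g
  chase (just v) g = [ const (ιˡ g) , ιʳ ]′ (splitAt (n G) v)

  chase-ιˡ : ∀ b x g → chase (if b then nothing else just (ιˡ x)) g ≡ ιˡ g
  chase-ιˡ true  x g = refl
  chase-ιˡ false x g rewrite splitAt-↑ˡ (n G) x (n J) = refl

  chase-view-ιˡ : ∀ {k} (c : Config (G ∨ᴳ J) k) x g → chase (view (G ∨ᴳ J) k c (ιˡ x)) g ≡ ιˡ g
  chase-view-ιˡ {k} c x g = chase-ιˡ (allFin k λ i → adj (G ∨ᴳ J) (c i) (ιˡ x)) x g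

  chase-ιʳ : ∀ z g → chase (just (ιʳ z)) g ≡ ιʳ z
  chase-ιʳ z g rewrite splitAt-↑ʳ (n G) (n J) z = refl

  module _ {k} (c : Config (G ∨ᴳ J) (suc k)) (c′ : Config G k) (guard : V J)
           (c₀ : c zero ≡ ιʳ guard) (c₊ : ∀ i → c (suc i) ≡ ιˡ (c′ i)) where

    visible-ιˡ : ∀ x → adj (G ∨ᴳ J) (c zero) (ιˡ x) ∧ allFin k (λ i → adj (G ∨ᴳ J) (c (suc i)) (ιˡ x))
                       ≡ allFin k (λ i → adj G (c′ i) x)
    visible-ιˡ x rewrite c₀ | adj-ιʳ-ιˡ guard x =
      allFin-cong k λ i → trans (cong (λ u → adj (G ∨ᴳ J) u (ιˡ x)) (c₊ i)) (adj-ιˡ-ιˡ (c′ i) x)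

    seenInG-view-ιˡ : ∀ x → seenInG (view (G ∨ᴳ J) (suc k) c (ιˡ x)) ≡ view G k c′ x
    seenInG-view-ιˡ x = begin
      seenInG (view (G ∨ᴳ J) (suc k) c (ιˡ x))  ≡⟨ seenInG-ιˡ _ x ⟩
      (if _ then nothing else just x)           ≡⟨ cong (λ b → if b then nothing else just x) (visible-ιˡ x) ⟩
      view G k c′ x                             ∎

  view-ιʳ-isolated : ∀ {k} (c : Config (G ∨ᴳ J) (suc k)) {w} → (∀ u → adj J w u ≡ false) →
                     c zero ≡ ιʳ w → ∀ z → view (G ∨ᴳ J) (suc k) c (ιʳ z) ≡ just (ιʳ z)
  view-ιʳ-isolated c {w} isolated c₀ z rewrite c₀ | adj-ιʳ-ιʳ w z | isolated z = refl

module Guarded (G J : Graph) (w : V J) (isolated : ∀ u → adj J w u ≡ false)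
               {k} (S : CopStrategy G (suc k)) where
  open Join G J

  H : Graph
  H = G ∨ᴳ J

  replay : List⁺ (Obs H (suc (suc k))) → List⁺ (Obs G (suc k))
  replay (o ∷ os) = replayFrom o os
    where
      replayFrom : Obs H (suc (suc k)) → List (Obs H (suc (suc k))) → List⁺ (Obs G (suc k))
      replayFrom o []        = [ (start S , seenInG (proj₂ o)) ]
      replayFrom o (o′ ∷ os) = let h = replayFrom o′ os in (move S h , seenInG (proj₂ o)) ∷⁺ h

  guarded : CopStrategy H (suc (suc k))
  guarded = record
    { start = λ where
        zero    → ιʳ w
        (suc i) → ιˡ (start S i)
    ; move  = λ where
        h zero    → proj₁ (head h) zero
        h (suc i) → moveToward H (proj₁ (head h) (suc i)) (chase (proj₂ (head h)) (move S (replay h) i))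
    ; legal = λ where
        h zero    → inj₁ refl
        h (suc i) → moveToward-legal H _ _
    }

  module Play (r : ℕ → V H) (legalR : LegalRobber H r) where

    copsH : ℕ → Config H (suc (suc k))
    copsH = cops guarded r

    -- while the robber is in G this is its position; once it enters J it is caught
    -- anyway, so there the shadow may do anything legal
    shadow : ℕ → V G
    shadow zero    = projˡ (start S zero) (r zero)
    shadow (suc t) = moveToward G (shadow t) (projˡ (shadow t) (r (suc t)))

    shadow-legal : LegalRobber G shadow
    shadow-legal t = moveToward-legal G (shadow t) _

    copsG : ℕ → Config G (suc k)
    copsG = cops S shadow

    guard-stays : ∀ t → copsH t zero ≡ ιʳ w
    guard-stays zero    = refl
    guard-stays (suc t) = guard-stays t

    record Tracking (t : ℕ) : Set where
      field
        robber   : r t ≡ ιˡ (shadow t)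
        chasers  : ∀ i → copsH t (suc i) ≡ ιˡ (copsG t i)
        replayed : replay (history guarded r t) ≡ history S shadow t
    open Tracking

    sees-shadow : ∀ t → r t ≡ ιˡ (shadow t) → (∀ i → copsH t (suc i) ≡ ιˡ (copsG t i)) →
                  seenInG (view H (suc (suc k)) (copsH t) (r t)) ≡ view G (suc k) (copsG t) (shadow t)
    sees-shadow t r≡ chasers rewrite r≡ =
      seenInG-view-ιˡ (copsH t) (copsG t) w (guard-stays t) chasers (shadow t)

    chasers-next : ∀ {t} → Tracking t → ∀ i → copsH (suc t) (suc i) ≡ ιˡ (copsG (suc t) i)
    chasers-next {t} tr i = begin
      moveToward H (copsH t (suc i)) (chase (proj₂ (head h)) g)
        ≡⟨ cong₂ (moveToward H) (chasers tr i) (cong (λ m → chase m g) sighting) ⟩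
      moveToward H (ιˡ (copsG t i)) (chase (view H _ (copsH t) (ιˡ (shadow t))) g)
        ≡⟨ cong (moveToward H (ιˡ (copsG t i))) (chase-view-ιˡ (copsH t) (shadow t) g) ⟩
      moveToward H (ιˡ (copsG t i)) (ιˡ g)
        ≡⟨ cong (λ h′ → moveToward H (ιˡ (copsG t i)) (ιˡ (move S h′ i))) (replayed tr) ⟩
      moveToward H (ιˡ (copsG t i)) (ιˡ (copsG (suc t) i))
        ≡⟨ moveToward-reaches H (Step-ιˡ⁺ (legal S (history S shadow t) i)) ⟩
      ιˡ (copsG (suc t) i) ∎
      where
        h = history guarded r t
        g = move S (replay h) i
        sighting : proj₂ (head h) ≡ view H _ (copsH t) (ιˡ (shadow t))
        sighting = trans (history-sighting guarded r t) (cong (view H _ (copsH t)) (robber tr))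

    tracking-zero : ∀ {x} → r zero ≡ ιˡ x → Tracking zero
    tracking-zero {x} r₀ = record { robber = robber₀ ; chasers = λ _ → refl
                                  ; replayed = cong (λ o → [ (start S , o) ]) (sees-shadow zero robber₀ λ _ → refl) }
      where
        robber₀ : r zero ≡ ιˡ (shadow zero)
        robber₀ rewrite r₀ | projˡ-ιˡ (start S zero) x = refl

    shadow-follows : ∀ {t x} → Tracking t → r (suc t) ≡ ιˡ x → shadow (suc t) ≡ x
    shadow-follows {t} {x} tr r₊ rewrite r₊ | projˡ-ιˡ (shadow t) x =
      moveToward-reaches G (Step-ιˡ⁻ (subst₂ (Step H) (robber tr) r₊ (legalR t)))

    tracking-suc : ∀ {t x} → Tracking t → r (suc t) ≡ ιˡ x → Tracking (suc t)
    tracking-suc {t} tr r₊ = record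
      { robber   = robber₊
      ; chasers  = chasers-next tr
      ; replayed = cong₂ (λ o h → (move S h , o) ∷⁺ h)
                         (sees-shadow (suc t) robber₊ (chasers-next tr)) (replayed tr)
      }
      where
        robber₊ : r (suc t) ≡ ιˡ (shadow (suc t))
        robber₊ = trans r₊ (cong ιˡ (sym (shadow-follows tr r₊)))

    caught-in-J : ∀ t {y z} → copsH t (suc zero) ≡ ιˡ y → r t ≡ ιʳ z → Captured guarded r
    caught-in-J t {y} {z} chaser r≡ = t , suc zero , inj₂ (begin
      moveToward H (copsH t (suc zero)) (chase (proj₂ (head h)) g)
        ≡⟨ cong₂ (λ u m → moveToward H u (chase m g)) chaser sighting ⟩
      moveToward H (ιˡ y) (chase (just (ιʳ z)) g)
        ≡⟨ cong (moveToward H (ιˡ y)) (chase-ιʳ z g) ⟩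
      moveToward H (ιˡ y) (ιʳ z)
        ≡⟨ moveToward-reaches H (inj₂ (adj-ιˡ-ιʳ y z)) ⟩
      ιʳ z
        ≡⟨ sym r≡ ⟩
      r t ∎)
      where
        h = history guarded r t
        g = move S (replay h) zero
        sighting : proj₂ (head h) ≡ just (ιʳ z)
        sighting = begin
          proj₂ (head h)                   ≡⟨ history-sighting guarded r t ⟩
          view H _ (copsH t) (r t)         ≡⟨ cong (view H _ (copsH t)) r≡ ⟩
          view H _ (copsH t) (ιʳ z)        ≡⟨ view-ιʳ-isolated (copsH t) isolated (guard-stays t) z ⟩
          just (ιʳ z)                      ∎

    tracking-or-captured : ∀ t → Tracking t ⊎ Captured guarded r
    tracking-or-captured zero with ιˡ-or-ιʳ (r zero)
    ... | inj₁ (_ , r₀) = inj₁ (tracking-zero r₀)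
    ... | inj₂ (_ , r₀) = inj₂ (caught-in-J zero refl r₀)
    tracking-or-captured (suc t) with tracking-or-captured t
    ... | inj₂ captured = inj₂ captured
    ... | inj₁ tr with ιˡ-or-ιʳ (r (suc t))
    ...   | inj₁ (_ , r₊) = inj₁ (tracking-suc tr r₊)
    ...   | inj₂ (_ , r₊) = inj₂ (caught-in-J (suc t) (chasers-next tr zero) r₊)

    capture-lifts : Captured S shadow → Captured guarded r
    capture-lifts (T , i , caught) with tracking-or-captured T
    ... | inj₂ captured = captured
    ... | inj₁ tr with caught
    ...   | inj₁ now  = T , suc i , inj₁ (trans (chasers tr i) (trans (cong ιˡ now) (sym (robber tr))))
    ...   | inj₂ next = T , suc i , inj₂ (trans (chasers-next tr i) (trans (cong ιˡ next) (sym (robber tr))))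

  guarded-wins : Winning S → Winning guarded
  guarded-wins wins r legalR = Play.capture-lifts r legalR (wins (Play.shadow r legalR) (Play.shadow-legal r legalR))

CopsWin-join : ∀ G J → HasIsolatedVertex J → ∀ k → CopsWin G (suc k) → CopsWin (G ∨ᴳ J) (suc (suc k))
CopsWin-join G J (w , isolated) k (S , wins) = guarded , guarded-wins wins
  where open Guarded G J w isolated S

mainTheorem11 : (G J : Graph) → Connected G → HasIsolatedVertex J →
    (a b : ℕ) → IsHyperopicCopNumber G a → IsHyperopicCopNumber (G ∨ᴳ J) b →
    b ≤ a + 1
mainTheorem11 G J (0<n , _) _        zero    b (G-wins , _) _ =
  ⊥-elim (¬CopsWin-zero G (fromℕ< 0<n) G-wins)
mainTheorem11 G J _         isolated (suc a) b (G-wins , _) (_ , minimal) =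
  minimal (suc a + 1) (subst (CopsWin (G ∨ᴳ J)) (+-comm 1 (suc a)) (CopsWin-join G J isolated a G-wins))
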